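{- Let $n$ be a positive integer divisible by an integer $s\ge2$, and let $r\le n/s$ be the degree of some divisor of $X^{n/s}+1$ in $\mathbb F_2[X]$. Then $F_{\mathrm{inv}}$ over $\mathbb F_{2^n}$ is not $(sr)$th order sum-free.
   Context: $F_{\mathrm{inv}}:\mathbb F_{2^n}\to\mathbb F_{2^n}$ is defined by $F_{\mathrm{inv}}(x)=x^{2^n-2}$ (so $F_{\mathrm{inv}}(x)=x^{ -1}$ for $x\ne0$ and $F_{\mathrm{inv}}(0)=0$). For an integer $0\le k\le n$, a function $F:\mathbb F_{2^n}\to\mathbb F_{2^n}$ is called $k$th order sum-free if $\sum_{x\in A}F(x)\ne 0$ for every $k$-dimensional affine $\mathbb F_2$-subspace $A$ of $\mathbb F_{2^n}$. -}

module Defs where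

open import Data.Nat using (ℕ; zero; suc; _^_; _∸_; _<_)
open import Data.Bool using (Bool; true; false; _xor_; _∧_; if_then_else_)
open import Data.List using (List; []; _∷_)
open import Data.Fin using (Fin)
open import Data.Vec using (Vec; []; _∷_; replicate)
open import Data.Product using (∃; _×_)
open import Relation.Binary.PropositionalEquality using (_≡_; _≢_)
open import Algebra.Structures using (IsCommutativeRing)
open import Function.Bundles using (_↔_)

-- The finite field F_{2^n}, given abstractly: a field (commutative ring
-- with 0 ≠ 1 in which every nonzero element is invertible) with exactly
-- 2^n elements.  Such a field is unique up to isomorphism, so quantifying
-- over all of them is the same as speaking of "the" field F_{2^n}.

record FiniteField2^ (n : ℕ) : Set₁ where
  infixl 6 _+_
  infixl 7 _*_
  field
    Carrier : Set
    _+_ _*_ : Carrier → Carrier → Carrier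
    -_      : Carrier → Carrier
    0# 1#   : Carrier
    isCommutativeRing : IsCommutativeRing _≡_ _+_ _*_ -_ 0# 1#
    0≢1     : 0# ≢ 1#
    inverse : ∀ x → x ≢ 0# → ∃ λ y → x * y ≡ 1#
    card    : Fin (2 ^ n) ↔ Carrier

  pow : Carrier → ℕ → Carrier
  pow x zero    = 1#
  pow x (suc k) = x * pow x k

  Finv : Carrier → Carrier
  Finv x = pow x (2 ^ n ∸ 2)

  combo : ∀ {k} → Vec Carrier k → Vec Bool k → Carrier
  combo []       []            = 0#
  combo (v ∷ vs) (true  ∷ bs)  = v + combo vs bs
  combo (v ∷ vs) (false ∷ bs)  = combo vs bs

  LinIndep : ∀ {k} → Vec Carrier k → Set
  LinIndep {k} vs = ∀ (S : Vec Bool k) → S ≢ replicate k false → combo vs S ≢ 0#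

  -- Σ_{x ∈ a + span(v_1..v_k)} F(x), summing over all 2^k combinations
  affSum : (Carrier → Carrier) → ∀ {k} → Carrier → Vec Carrier k → Carrier
  affSum F a []       = F a
  affSum F a (v ∷ vs) = affSum F a vs + affSum F (a + v) vs

  SumFree : ℕ → (Carrier → Carrier) → Set
  SumFree k F = ∀ (a : Carrier) (vs : Vec Carrier k) → LinIndep vs → affSum F a vs ≢ 0#

-- Polynomials over F_2 as coefficient lists (lowest degree first).

Poly₂ : Set
Poly₂ = List Bool

coeff : Poly₂ → ℕ → Bool
coeff []       _       = false
coeff (b ∷ _)  zero    = b
coeff (_ ∷ bs) (suc i) = coeff bs i

-- coefficient k of p*q : XOR over i + j = k of p_i ∧ q_j
mulCoeffAux : (ℕ → Bool) → (ℕ → Bool) → ℕ → ℕ → Bool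
mulCoeffAux p q zero    j = p zero ∧ q j
mulCoeffAux p q (suc i) j = (p (suc i) ∧ q j) xor mulCoeffAux p q i (suc j)

mulCoeff : Poly₂ → Poly₂ → ℕ → Bool
mulCoeff p q k = mulCoeffAux (coeff p) (coeff q) k 0

X^_+1 : ℕ → ℕ → Bool
(X^ m +1) zero    = true xor (if m Data.Nat.≡ᵇ 0 then true else false)
(X^ m +1) (suc i) = if m Data.Nat.≡ᵇ suc i then true else false

HasDegree : Poly₂ → ℕ → Set
HasDegree p r = coeff p r ≡ true × (∀ j → r < j → coeff p j ≡ false)

DividesX^+1 : Poly₂ → ℕ → Set
DividesX^+1 p m = ∃ λ (q : Poly₂) → ∀ k → mulCoeff p q k ≡ (X^ m +1) k

{-# OPTIONS --safe #-}
module Submission where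

-- Let F ⊆ K be the fixed field of x ↦ x ^ (2 ^ s).  Every F-linear subspace V ⊆ K is mapped
-- onto itself by x ↦ λ x for λ ∈ F \ {0}, so the sum Σ of F_inv over V satisfies
-- Σ = F_inv(λ) Σ = λ⁻¹ Σ, and choosing λ ≠ 1 (possible as s ≥ 2) gives Σ = 0.  F-subspaces of
-- F-dimension r, that is of F₂-dimension s r, exist for all r ≤ n / s because F has 2 ^ s
-- elements: at most 2 ^ s as roots of x ^ (2 ^ s) + x, and at least 2 ^ s because the
-- F₂-linear trace K → F has a kernel of at most 2 ^ (n - s) roots of a polynomial.

open import Defs
open import Level using (0ℓ)
open import Data.Bool using (Bool; true; false; _xor_)
import Data.Bool.Properties as Boolₚ
open import Data.Empty using (⊥-elim)
open import Data.Fin using (Fin; zero; suc; combine; quotient; remainder; _↑ˡ_; _↑ʳ_)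
open import Data.Fin.Properties using (2↔Bool; remQuot-combine; combine-remQuot; injective⇒≤; any?)
import Data.Fin.Properties as Finₚ
open import Data.Fin.Permutation using (Permutation′)
open import Data.Nat using (ℕ; zero; suc; _∸_; _^_; _/_; _≤_; _<_; z≤n; s≤s; NonZero)
import Data.Nat as ℕ
open import Data.Nat.Divisibility using (_∣_; divides)
open import Data.Nat.DivMod using (m*n/n≡m)
open import Data.Nat.Properties
  using (^-monoʳ-<; ^-*-assoc; m^n>0; ≮⇒≥; <⇒≱; ≤-refl; ≤-reflexive; ≤-trans; n≤1+n; +-suc)
import Data.Nat.Properties as ℕₚ
open import Data.Product using (∃; ∃₂; _×_; _,_; proj₁; proj₂)
open import Data.Sum using (_⊎_; inj₁; inj₂)
open import Data.Vec using (Vec; []; _∷_; replicate; zipWith; map; _++_; splitAt)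
import Data.Vec.Properties as Vecₚ
open import Data.Vec.Relation.Unary.All using (All; []; _∷_)
open import Function using (_∘_)
open import Function.Bundles using (Inverse; Injection; _↔_; mk↔ₛ′)
open import Function.Definitions using (Injective)
open import Function.Properties.Inverse using (↔-sym; ↔-trans; ↔⇒↣)
open import Relation.Nullary using (¬_; Dec; yes; no; map′)
open import Relation.Nullary.Decidable using (_×-dec_; ¬?; decidable-stable)
open import Relation.Unary using (Decidable)
open import Relation.Binary.Definitions using (DecidableEquality)
open import Relation.Binary.PropositionalEquality
open import Algebra.Bundles using (CommutativeMonoid; CommutativeRing; CancellativeCommutativeSemiring)
import Algebra.Properties.CancellativeCommutativeSemiring as CancellativeProperties
import Algebra.Properties.CommutativeMonoid.Sum as MonoidSum
import Algebra.Properties.CommutativeSemiring.Exp as SemiringExp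
import Algebra.Properties.Ring as RingProperties
import Algebra.Properties.Semiring.Sum as SemiringSum
import Algebra.Solver.Ring.NaturalCoefficients.Default as RingSolver

2^-cancel-≤ : ∀ {a b} → 2 ^ a ≤ 2 ^ b → a ≤ b
2^-cancel-≤ le = ≮⇒≥ (λ b<a → <⇒≱ (^-monoʳ-< 2 (s≤s (s≤s z≤n)) b<a) le)

subset : ∀ k → Fin (2 ^ k) → Vec Bool k
subset zero    _ = []
subset (suc k) i = Inverse.to 2↔Bool (quotient {2} (2 ^ k) i) ∷ subset k (remainder {2} (2 ^ k) i)

index : ∀ {k} → Vec Bool k → Fin (2 ^ k)
index []      = zero
index (b ∷ S) = combine (Inverse.from 2↔Bool b) (index S)

subset-combine : ∀ {k} b (i : Fin (2 ^ k)) → subset (suc k) (combine b i) ≡ Inverse.to 2↔Bool b ∷ subset k i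
subset-combine {k} b i = cong₂ _∷_ (cong (Inverse.to 2↔Bool ∘ proj₁) split) (cong (subset k ∘ proj₂) split)
  where split = remQuot-combine {2} {2 ^ k} b i

subset-index : ∀ {k} (S : Vec Bool k) → subset k (index S) ≡ S
subset-index []      = refl
subset-index (b ∷ S) = trans (subset-combine (Inverse.from 2↔Bool b) (index S))
                             (cong₂ _∷_ (Inverse.strictlyInverseˡ 2↔Bool b) (subset-index S))

index-subset : ∀ k (i : Fin (2 ^ k)) → index (subset k i) ≡ i
index-subset zero    zero = refl
index-subset (suc k) i = begin
  combine (Inverse.from 2↔Bool (Inverse.to 2↔Bool q)) (index (subset k r))
    ≡⟨ cong₂ combine (Inverse.strictlyInverseʳ 2↔Bool q) (index-subset k r) ⟩
  combine q r
    ≡⟨ combine-remQuot {2} (2 ^ k) i ⟩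
  i ∎
  where
  open ≡-Reasoning
  q = quotient {2} (2 ^ k) i
  r = remainder {2} (2 ^ k) i

Vec-Bool↔Fin : ∀ k → Vec Bool k ↔ Fin (2 ^ k)
Vec-Bool↔Fin k = mk↔ₛ′ index (subset k) (index-subset k) subset-index

Vec-Bool-injection⇒≤ : ∀ {a b} (f : Vec Bool a → Vec Bool b) → Injective _≡_ _≡_ f → a ≤ b
Vec-Bool-injection⇒≤ {a} f f-inj = 2^-cancel-≤ (injective⇒≤ {f = index ∘ f ∘ subset a} inj)
  where
  inj : Injective _≡_ _≡_ (index ∘ f ∘ subset a)
  inj {i} {j} eq = begin
    i                     ≡⟨ index-subset a i ⟨
    index (subset a i)    ≡⟨ cong index (f-inj f[subset-i]≡f[subset-j]) ⟩
    index (subset a j)    ≡⟨ index-subset a j ⟩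
    j                     ∎
    where
    open ≡-Reasoning
    f[subset-i]≡f[subset-j] = trans (sym (subset-index _)) (trans (cong (subset _) eq) (subset-index _))

any?-↔Fin : ∀ {m} {A : Set} {P : A → Set} → A ↔ Fin m → Decidable P → Dec (∃ P)
any?-↔Fin {P = P} A↔Fin P? =
  map′ (λ (i , p) → from i , p) (λ (x , p) → to x , subst P (sym (strictlyInverseʳ x)) p) (any? (P? ∘ from))
  where open Inverse A↔Fin

replicate-++ : ∀ {A : Set} {x : A} m n → replicate m x ++ replicate n x ≡ replicate (m ℕ.+ n) x
replicate-++ zero    n = refl
replicate-++ (suc m) n = cong (_ ∷_) (replicate-++ m n)

2≤2^n⇒2^n≡2*2^[n∸1] : ∀ {n} → 2 ≤ 2 ^ n → 2 ^ n ≡ 2 ℕ.* 2 ^ (n ∸ 1)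
2≤2^n⇒2^n≡2*2^[n∸1] {zero}  (s≤s ())
2≤2^n⇒2^n≡2*2^[n∸1] {suc n} _ = refl

module _ {c ℓ} (M : CommutativeMonoid c ℓ) where
  open CommutativeMonoid M using (Carrier; _≈_; _∙_; assoc; identityˡ; identityʳ; ∙-congˡ)
    renaming (trans to ≈-trans; sym to ≈-sym; reflexive to ≈-reflexive)
  open MonoidSum M using (sum; sum-permute; sum-cong-≗)

  sum-↑ : ∀ p q (f : Fin (p ℕ.+ q) → Carrier) → sum f ≈ sum (f ∘ (_↑ˡ q)) ∙ sum (f ∘ (p ↑ʳ_))
  sum-↑ zero    q f = ≈-sym (identityˡ _)
  sum-↑ (suc p) q f = ≈-trans (∙-congˡ (sum-↑ p q (f ∘ suc))) (≈-sym (assoc _ _ _))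

  sum-combine : ∀ m (f : Fin (2 ℕ.* m) → Carrier) →
                sum f ≈ sum (f ∘ combine {2} {m} zero) ∙ sum (f ∘ combine {2} {m} (suc zero))
  sum-combine m f = ≈-trans (sum-↑ m (m ℕ.+ 0) f) (∙-congˡ (≈-trans (sum-↑ m 0 (f ∘ (m ↑ʳ_))) (identityʳ _)))

  sum-invariant : ∀ {m} {A : Set} (e : A ↔ Fin m) (σ : A ↔ A) (g : A → Carrier) →
                  sum (g ∘ Inverse.from e) ≈ sum (g ∘ Inverse.to σ ∘ Inverse.from e)
  sum-invariant e σ g =
    ≈-trans (sum-permute (g ∘ from) π) (≈-reflexive (sum-cong-≗ λ i → cong g (strictlyInverseʳ (Inverse.to σ (from i)))))
    where
    open Inverse e
    π : Permutation′ _
    π = ↔-trans (↔-sym e) (↔-trans σ e)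

module _ {n : ℕ} (K : FiniteField2^ n) where
  open FiniteField2^ K

  commutativeRing : CommutativeRing 0ℓ 0ℓ
  commutativeRing = record { isCommutativeRing = isCommutativeRing }

  open CommutativeRing commutativeRing
    using ( commutativeSemiring; semiring; ring; *-commutativeMonoid; +-commutativeMonoid; isCommutativeSemiring
          ; +-assoc; +-identityˡ; +-identityʳ; -‿inverseʳ
          ; *-assoc; *-comm; *-identityˡ; *-identityʳ; distribˡ; distribʳ; zeroˡ; zeroʳ )
  open RingProperties ring using (-‿involutive; -1*x≈-x; +-inverseʳ-unique; +-cancelʳ; x+x≈x⇒x≈0)
  open SemiringExp commutativeSemiring using (^-homo-*; ^-assocʳ; ^-distrib-*) renaming (_^_ to _^ᴷ_)
  open RingSolver commutativeSemiring using (solve; _:=_; _:+_; _:*_; con)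
  module Π = MonoidSum *-commutativeMonoid
  module Σ = SemiringSum semiring

  from-injective : Injective _≡_ _≡_ (Inverse.from card)
  from-injective = Injection.injective (↔⇒↣ (↔-sym card))

  _≟_ : DecidableEquality Carrier
  x ≟ y = map′ from-injective (cong (Inverse.from card)) (Inverse.from card x Finₚ.≟ Inverse.from card y)

  1≢0 : 1# ≢ 0#
  1≢0 = 0≢1 ∘ sym

  inv : (x : Carrier) → x ≢ 0# → Carrier
  inv x x≢0 = proj₁ (inverse x x≢0)

  inv-inverseʳ : ∀ x (x≢0 : x ≢ 0#) → x * inv x x≢0 ≡ 1#
  inv-inverseʳ x x≢0 = proj₂ (inverse x x≢0)

  inv-inverseˡ : ∀ x (x≢0 : x ≢ 0#) → inv x x≢0 * x ≡ 1#
  inv-inverseˡ x x≢0 = trans (*-comm _ x) (inv-inverseʳ x x≢0)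

  inv-cancelˡ : ∀ x (x≢0 : x ≢ 0#) y → inv x x≢0 * (x * y) ≡ y
  inv-cancelˡ x x≢0 y = trans (sym (*-assoc _ x y)) (trans (cong (_* y) (inv-inverseˡ x x≢0)) (*-identityˡ y))

  inv-cancelʳ : ∀ x (x≢0 : x ≢ 0#) y → x * (inv x x≢0 * y) ≡ y
  inv-cancelʳ x x≢0 y = trans (sym (*-assoc x _ y)) (trans (cong (_* y) (inv-inverseʳ x x≢0)) (*-identityˡ y))

  *-cancelˡ-nonZero : ∀ x y z → x ≢ 0# → x * y ≡ x * z → y ≡ z
  *-cancelˡ-nonZero x y z x≢0 eq =
    trans (sym (inv-cancelˡ x x≢0 y)) (trans (cong (inv x x≢0 *_) eq) (inv-cancelˡ x x≢0 z))

  cancellativeCommutativeSemiring : CancellativeCommutativeSemiring 0ℓ 0ℓ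
  cancellativeCommutativeSemiring = record
    { isCancellativeCommutativeSemiring = record
      { isCommutativeSemiring = isCommutativeSemiring
      ; *-cancelˡ-nonZero     = *-cancelˡ-nonZero } }

  open CancellativeProperties cancellativeCommutativeSemiring using (xy≈0⇒x≈0∨y≈0; x≉0∧y≉0⇒xy≉0)

  *-nonZero : ∀ {x y} → x ≢ 0# → y ≢ 0# → x * y ≢ 0#
  *-nonZero = x≉0∧y≉0⇒xy≉0 _≟_

  *-zeroDivisor : ∀ {x y} → x * y ≡ 0# → x ≡ 0# ⊎ y ≡ 0#
  *-zeroDivisor = xy≈0⇒x≈0∨y≈0 _≟_

  *-↔ : ∀ x → x ≢ 0# → Carrier ↔ Carrier
  *-↔ x x≢0 = mk↔ₛ′ (x *_) (inv x x≢0 *_) (inv-cancelʳ x x≢0) (inv-cancelˡ x x≢0)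

  pow≡^ : ∀ x k → pow x k ≡ x ^ᴷ k
  pow≡^ x zero    = refl
  pow≡^ x (suc k) = cong (x *_) (pow≡^ x k)

  pow-+ : ∀ x a b → pow x (a ℕ.+ b) ≡ pow x a * pow x b
  pow-+ x a b rewrite pow≡^ x (a ℕ.+ b) | pow≡^ x a | pow≡^ x b = ^-homo-* x a b

  pow-* : ∀ x a b → pow x (a ℕ.* b) ≡ pow (pow x a) b
  pow-* x a b rewrite pow≡^ (pow x a) b | pow≡^ x (a ℕ.* b) | pow≡^ x a = sym (^-assocʳ x a b)

  pow-distrib-* : ∀ x y k → pow (x * y) k ≡ pow x k * pow y k
  pow-distrib-* x y k rewrite pow≡^ (x * y) k | pow≡^ x k | pow≡^ y k = ^-distrib-* x y k

  pow-1# : ∀ k → pow 1# k ≡ 1#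
  pow-1# zero    = refl
  pow-1# (suc k) = trans (*-identityˡ _) (pow-1# k)

  pow-0# : ∀ k → 0 < k → pow 0# k ≡ 0#
  pow-0# (suc k) _ = zeroˡ _

  pow-2 : ∀ x → pow x 2 ≡ x * x
  pow-2 x = cong (x *_) (*-identityʳ x)

  element : Fin (2 ^ n) → Carrier
  element = Inverse.to card

  ∏ : (Carrier → Carrier) → Carrier
  ∏ g = Π.sum (g ∘ element)

  ∏-invariant : ∀ (σ : Carrier ↔ Carrier) g → ∏ g ≡ ∏ (g ∘ Inverse.to σ)
  ∏-invariant = sum-invariant *-commutativeMonoid (↔-sym card)

  ∏-distrib : ∀ f g → ∏ (λ y → f y * g y) ≡ ∏ f * ∏ g
  ∏-distrib f g = Π.∑-distrib-+ (f ∘ element) (g ∘ element)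

  ∏-const : ∀ x → ∏ (λ _ → x) ≡ pow x (2 ^ n)
  ∏-const x = trans (Π.sum-replicate (2 ^ n)) (sym (pow≡^ x (2 ^ n)))

  ∏-nonZero : ∀ g → (∀ y → g y ≢ 0#) → ∏ g ≢ 0#
  ∏-nonZero g g≢0 = product-nonZero (g ∘ element) (g≢0 ∘ element)
    where
    product-nonZero : ∀ {m} (f : Fin m → Carrier) → (∀ i → f i ≢ 0#) → Π.sum f ≢ 0#
    product-nonZero {zero}  f f≢0 = 1≢0
    product-nonZero {suc m} f f≢0 = *-nonZero (f≢0 zero) (product-nonZero (f ∘ suc) (f≢0 ∘ suc))

  ∏-single : ∀ y₀ g → (∀ y → y ≢ y₀ → g y ≡ 1#) → ∏ g ≡ g y₀
  ∏-single y₀ g g≡1 = trans (product-single (g ∘ element) (from y₀) g∘element≡1) (cong g (strictlyInverseˡ y₀))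
    where
    open Inverse card
    g∘element≡1 : ∀ i → i ≢ from y₀ → g (element i) ≡ 1#
    g∘element≡1 i i≢i₀ = g≡1 _ λ eq → i≢i₀ (trans (sym (strictlyInverseʳ i)) (cong from eq))
    product-single : ∀ {m} (f : Fin m → Carrier) i₀ → (∀ i → i ≢ i₀ → f i ≡ 1#) → Π.sum f ≡ f i₀
    product-single {suc m} f zero f≡1 =
      trans (cong (f zero *_) (trans (Π.sum-cong-≗ (λ j → f≡1 (suc j) λ ())) (Π.sum-replicate-zero m)))
            (*-identityʳ _)
    product-single f (suc i₀) f≡1 =
      trans (cong₂ _*_ (f≡1 zero λ ()) (product-single (f ∘ suc) i₀ λ i i≢i₀ → f≡1 (suc i) (i≢i₀ ∘ Finₚ.suc-injective)))
            (*-identityˡ _)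

  ifZero : Carrier → Carrier → Carrier → Carrier
  ifZero y a b with y ≟ 0#
  ... | yes _ = a
  ... | no  _ = b

  ifZero-0 : ∀ a b → ifZero 0# a b ≡ a
  ifZero-0 a b with 0# ≟ 0#
  ... | yes _   = refl
  ... | no  0≢0 = ⊥-elim (0≢0 refl)

  ifZero-nonZero : ∀ {y} a b → y ≢ 0# → ifZero y a b ≡ b
  ifZero-nonZero {y} a b y≢0 with y ≟ 0#
  ... | yes y≡0 = ⊥-elim (y≢0 y≡0)
  ... | no  _   = refl

  orOne : Carrier → Carrier
  orOne y = ifZero y 1# y

  orOne≢0 : ∀ y → orOne y ≢ 0#
  orOne≢0 y with y ≟ 0#
  ... | yes _   = 1≢0
  ... | no  y≢0 = y≢0

  -- ∏ orOne is the product of the nonzero elements, which multiplication by x ≢ 0# permutes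
  fermat : ∀ x → pow x (2 ^ n) ≡ x
  fermat x with x ≟ 0#
  ... | yes refl = pow-0# (2 ^ n) (m^n>0 2 n)
  ... | no  x≢0  = *-cancelˡ-nonZero P _ _ (∏-nonZero orOne orOne≢0) (begin
    P * pow x (2 ^ n)                  ≡⟨ *-comm P _ ⟩
    pow x (2 ^ n) * P                  ≡⟨ cong (_* P) (∏-const x) ⟨
    ∏ (λ _ → x) * P                    ≡⟨ ∏-distrib (λ _ → x) orOne ⟨
    ∏ (λ y → x * orOne y)              ≡⟨ Π.sum-cong-≗ (scale ∘ element) ⟩
    ∏ (λ y → orOne (x * y) * atZero y) ≡⟨ ∏-distrib (orOne ∘ (x *_)) atZero ⟩
    ∏ (orOne ∘ (x *_)) * ∏ atZero      ≡⟨ cong₂ _*_ (∏-invariant (*-↔ x x≢0) orOne) ∏atZero≡x ⟨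
    P * x                              ∎)
    where
    open ≡-Reasoning
    P = ∏ orOne
    atZero : Carrier → Carrier
    atZero y = ifZero y x 1#
    ∏atZero≡x : x ≡ ∏ atZero
    ∏atZero≡x = sym (trans (∏-single 0# atZero (λ _ → ifZero-nonZero x 1#)) (ifZero-0 x 1#))
    scale : ∀ y → x * orOne y ≡ orOne (x * y) * atZero y
    scale y with y ≟ 0#
    ... | yes refl = begin
      x * 1#               ≡⟨ *-identityʳ x ⟩
      x                    ≡⟨ *-identityˡ x ⟨
      1# * x               ≡⟨ cong (_* x) (trans (cong orOne (zeroʳ x)) (ifZero-0 1# 0#)) ⟨
      orOne (x * 0#) * x   ∎
    ... | no  y≢0  = trans (sym (*-identityʳ _)) (cong (_* 1#) (sym (ifZero-nonZero 1# _ (*-nonZero x≢0 y≢0))))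

  2≤2^n : 2 ≤ 2 ^ n
  2≤2^n = injective⇒≤ {f = from ∘ bit} bit-injective
    where
    open Inverse card
    bit : Fin 2 → Carrier
    bit zero    = 0#
    bit (suc _) = 1#
    bit-injective : Injective _≡_ _≡_ (from ∘ bit)
    bit-injective {zero}     {zero}     _  = refl
    bit-injective {suc zero} {suc zero} _  = refl
    bit-injective {zero}     {suc zero} eq = ⊥-elim (0≢1 (from-injective eq))
    bit-injective {suc zero} {zero}     eq = ⊥-elim (0≢1 (sym (from-injective eq)))

  -1#≡1# : - 1# ≡ 1#
  -1#≡1# = begin
    - 1#                                ≡⟨ fermat (- 1#) ⟨
    pow (- 1#) (2 ^ n)                  ≡⟨ cong (pow (- 1#)) (2≤2^n⇒2^n≡2*2^[n∸1] {n} 2≤2^n) ⟩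
    pow (- 1#) (2 ℕ.* 2 ^ (n ∸ 1))      ≡⟨ pow-* (- 1#) 2 (2 ^ (n ∸ 1)) ⟩
    pow (pow (- 1#) 2) (2 ^ (n ∸ 1))    ≡⟨ cong (λ y → pow y (2 ^ (n ∸ 1))) [-1]²≡1 ⟩
    pow 1# (2 ^ (n ∸ 1))                ≡⟨ pow-1# (2 ^ (n ∸ 1)) ⟩
    1#                                  ∎
    where
    open ≡-Reasoning
    [-1]²≡1 : pow (- 1#) 2 ≡ 1#
    [-1]²≡1 = trans (pow-2 (- 1#)) (trans (-1*x≈-x (- 1#)) (-‿involutive 1#))

  -x≡x : ∀ x → - x ≡ x
  -x≡x x = trans (sym (-1*x≈-x x)) (trans (cong (_* x) -1#≡1#) (*-identityˡ x))

  x+x≡0 : ∀ x → x + x ≡ 0#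
  x+x≡0 x = trans (cong (x +_) (sym (-x≡x x))) (-‿inverseʳ x)

  x+y≡0⇒x≡y : ∀ {x y} → x + y ≡ 0# → x ≡ y
  x+y≡0⇒x≡y {x} {y} eq = trans (sym (-x≡x x)) (sym (+-inverseʳ-unique x y eq))

  x≡y⇒x+y≡0 : ∀ {x y} → x ≡ y → x + y ≡ 0#
  x≡y⇒x+y≡0 {x} refl = x+x≡0 x

  pow-2-+ : ∀ a b → pow (a + b) 2 ≡ pow a 2 + pow b 2
  pow-2-+ a b = begin
    pow (a + b) 2                        ≡⟨ pow-2 (a + b) ⟩
    (a + b) * (a + b)                    ≡⟨ solve 2 (λ a b → (a :+ b) :* (a :+ b) := (a :* a :+ b :* b) :+ (a :* b :+ a :* b))
                                                      refl a b ⟩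
    (a * a + b * b) + (a * b + a * b)    ≡⟨ cong (_ +_) (x+x≡0 (a * b)) ⟩
    (a * a + b * b) + 0#                 ≡⟨ +-identityʳ _ ⟩
    a * a + b * b                        ≡⟨ cong₂ _+_ (pow-2 a) (pow-2 b) ⟨
    pow a 2 + pow b 2                    ∎
    where open ≡-Reasoning

  frobenius-+ : ∀ k a b → pow (a + b) (2 ^ k) ≡ pow a (2 ^ k) + pow b (2 ^ k)
  frobenius-+ zero    a b = trans (*-identityʳ _) (sym (cong₂ _+_ (*-identityʳ a) (*-identityʳ b)))
  frobenius-+ (suc k) a b = begin
    pow (a + b) (2 ℕ.* 2 ^ k)                         ≡⟨ pow-* (a + b) 2 (2 ^ k) ⟩
    pow (pow (a + b) 2) (2 ^ k)                       ≡⟨ cong (λ y → pow y (2 ^ k)) (pow-2-+ a b) ⟩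
    pow (pow a 2 + pow b 2) (2 ^ k)                   ≡⟨ frobenius-+ k (pow a 2) (pow b 2) ⟩
    pow (pow a 2) (2 ^ k) + pow (pow b 2) (2 ^ k)     ≡⟨ cong₂ _+_ (pow-* a 2 (2 ^ k)) (pow-* b 2 (2 ^ k)) ⟨
    pow a (2 ℕ.* 2 ^ k) + pow b (2 ℕ.* 2 ^ k)         ∎
    where open ≡-Reasoning

  -- Linear algebra over F₂

  any?K : ∀ {P : Carrier → Set} → Decidable P → Dec (∃ P)
  any?K = any?-↔Fin (↔-sym card)

  preimage : (Carrier → Carrier) → Carrier → Carrier
  preimage g y with any?K (λ x → g x ≟ y)
  ... | yes (x , _) = x
  ... | no  _       = y

  preimage-section : ∀ (g : Carrier → Carrier) x → g (preimage g (g x)) ≡ g x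
  preimage-section g x with any?K (λ x′ → g x′ ≟ g x)
  ... | yes (_ , gx′≡gx) = gx′≡gx
  ... | no  ∄x′          = ⊥-elim (∄x′ (x , refl))

  K↔Vec-Bool : Carrier ↔ Vec Bool n
  K↔Vec-Bool = ↔-trans (↔-sym card) (↔-sym (Vec-Bool↔Fin n))

  InSpan : ∀ {k} → Vec Carrier k → Carrier → Set
  InSpan vs x = ∃ λ S → combo vs S ≡ x

  InSpan? : ∀ {k} (vs : Vec Carrier k) → Decidable (InSpan vs)
  InSpan? {k} vs x = any?-↔Fin (Vec-Bool↔Fin k) (λ S → combo vs S ≟ x)

  combo-false : ∀ {k} (vs : Vec Carrier k) → combo vs (replicate k false) ≡ 0#
  combo-false []       = refl
  combo-false (v ∷ vs) = combo-false vs

  combo-xor : ∀ {k} (vs : Vec Carrier k) S T → combo vs (zipWith _xor_ S T) ≡ combo vs S + combo vs T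
  combo-xor []       []          []          = sym (+-identityˡ 0#)
  combo-xor (v ∷ vs) (false ∷ S) (false ∷ T) = combo-xor vs S T
  combo-xor (v ∷ vs) (false ∷ S) (true  ∷ T) = trans (cong (v +_) (combo-xor vs S T))
    (solve 3 (λ v a b → v :+ (a :+ b) := a :+ (v :+ b)) refl v (combo vs S) (combo vs T))
  combo-xor (v ∷ vs) (true  ∷ S) (false ∷ T) = trans (cong (v +_) (combo-xor vs S T)) (sym (+-assoc v _ _))
  combo-xor (v ∷ vs) (true  ∷ S) (true  ∷ T) = begin
    combo vs (zipWith _xor_ S T)          ≡⟨ combo-xor vs S T ⟩
    a + b                                 ≡⟨ +-identityˡ (a + b) ⟨
    0# + (a + b)                          ≡⟨ cong (_+ (a + b)) (x+x≡0 v) ⟨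
    (v + v) + (a + b)                     ≡⟨ solve 3 (λ v a b → (v :+ v) :+ (a :+ b) := (v :+ a) :+ (v :+ b))
                                                       refl v a b ⟩
    (v + a) + (v + b)                     ∎
    where
    open ≡-Reasoning
    a = combo vs S
    b = combo vs T

  combo-++ : ∀ {k l} (us : Vec Carrier k) (vs : Vec Carrier l) S T → combo (us ++ vs) (S ++ T) ≡ combo us S + combo vs T
  combo-++ []       vs []          T = sym (+-identityˡ _)
  combo-++ (u ∷ us) vs (false ∷ S) T = combo-++ us vs S T
  combo-++ (u ∷ us) vs (true  ∷ S) T = trans (cong (u +_) (combo-++ us vs S T)) (sym (+-assoc u _ _))

  combo-map : ∀ (g : Carrier → Carrier) → g 0# ≡ 0# → (∀ a b → g (a + b) ≡ g a + g b) →
              ∀ {k} (vs : Vec Carrier k) S → combo (map g vs) S ≡ g (combo vs S)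
  combo-map g g0 g+ []       []          = sym g0
  combo-map g g0 g+ (v ∷ vs) (false ∷ S) = combo-map g g0 g+ vs S
  combo-map g g0 g+ (v ∷ vs) (true  ∷ S) = trans (cong (g v +_) (combo-map g g0 g+ vs S)) (sym (g+ v _))

  span-0 : ∀ {k} (vs : Vec Carrier k) → InSpan vs 0#
  span-0 {k} vs = replicate k false , combo-false vs

  span-+ : ∀ {k} (vs : Vec Carrier k) {a b} → InSpan vs a → InSpan vs b → InSpan vs (a + b)
  span-+ vs (S , refl) (T , refl) = zipWith _xor_ S T , combo-xor vs S T

  span-++ˡ : ∀ {k l} (us : Vec Carrier k) (vs : Vec Carrier l) {x} → InSpan us x → InSpan (us ++ vs) x
  span-++ˡ {l = l} us vs (S , refl) = S ++ replicate l false ,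
    trans (combo-++ us vs S _) (trans (cong (_ +_) (combo-false vs)) (+-identityʳ _))

  span-++ʳ : ∀ {k l} (us : Vec Carrier k) (vs : Vec Carrier l) {x} → InSpan vs x → InSpan (us ++ vs) x
  span-++ʳ {k} us vs (T , refl) = replicate k false ++ T ,
    trans (combo-++ us vs _ T) (trans (cong (_+ _) (combo-false us)) (+-identityˡ _))

  span-++⁻ : ∀ {k l} (us : Vec Carrier k) (vs : Vec Carrier l) {x} → InSpan (us ++ vs) x →
             ∃₂ λ u v → InSpan us u × InSpan vs v × u + v ≡ x
  span-++⁻ {k} us vs (ST , refl) with splitAt k ST
  ... | S , T , refl = combo us S , combo vs T , (S , refl) , (T , refl) , sym (combo-++ us vs S T)

  span-map : ∀ (g : Carrier → Carrier) → g 0# ≡ 0# → (∀ a b → g (a + b) ≡ g a + g b) →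
             ∀ {k} (vs : Vec Carrier k) {x} → InSpan vs x → InSpan (map g vs) (g x)
  span-map g g0 g+ vs (S , refl) = S , combo-map g g0 g+ vs S

  span-least : ∀ (P : Carrier → Set) → P 0# → (∀ {a b} → P a → P b → P (a + b)) →
               ∀ {k} {vs : Vec Carrier k} → All P vs → ∀ {x} → InSpan vs x → P x
  span-least P P0 P+ []       ([]          , refl) = P0
  span-least P P0 P+ (_ ∷ ps) (false ∷ S , refl) = span-least P P0 P+ ps (S , refl)
  span-least P P0 P+ (p ∷ ps) (true  ∷ S , refl) = P+ p (span-least P P0 P+ ps (S , refl))

  Stable : Carrier → ∀ {k} → Vec Carrier k → Set
  Stable x vs = ∀ {y} → InSpan vs y → InSpan vs (x * y)

  LinIndep⇒≡false : ∀ {k} (vs : Vec Carrier k) → LinIndep vs → ∀ {S} → combo vs S ≡ 0# → S ≡ replicate k false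
  LinIndep⇒≡false {k} vs indep {S} eq =
    decidable-stable (Vecₚ.≡-dec Boolₚ._≟_ S (replicate k false)) (λ S≢false → indep S S≢false eq)

  LinIndep⇒combo-injective : ∀ {k} (vs : Vec Carrier k) → LinIndep vs → Injective _≡_ _≡_ (combo vs)
  LinIndep⇒combo-injective vs indep {S} {T} eq =
    xor≡false⇒≡ S T (LinIndep⇒≡false vs indep (trans (combo-xor vs S T) (x≡y⇒x+y≡0 eq)))
    where
    xor≡false⇒≡ : ∀ {k} (S T : Vec Bool k) → zipWith _xor_ S T ≡ replicate k false → S ≡ T
    xor≡false⇒≡ []          []          _  = refl
    xor≡false⇒≡ (false ∷ S) (false ∷ T) eq = cong (false ∷_) (xor≡false⇒≡ S T (Vecₚ.∷-injectiveʳ eq))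
    xor≡false⇒≡ (true  ∷ S) (true  ∷ T) eq = cong (true ∷_) (xor≡false⇒≡ S T (Vecₚ.∷-injectiveʳ eq))

  LinIndep-∷ : ∀ {k} {vs : Vec Carrier k} {y} → LinIndep vs → ¬ InSpan vs y → LinIndep (y ∷ vs)
  LinIndep-∷ indep y∉ (false ∷ S) S≢false eq = indep S (S≢false ∘ cong (false ∷_)) eq
  LinIndep-∷ indep y∉ (true  ∷ S) _       eq = y∉ (S , sym (x+y≡0⇒x≡y eq))

  coordinates-agree : ∀ {k} (vs : Vec Carrier k) {S T a b} → combo vs S ≡ a → combo vs T ≡ b → S ≡ T → a ≡ b
  coordinates-agree vs refl refl S≡T = cong (combo vs) S≡T

  LinIndep⇒≤n : ∀ {k} (vs : Vec Carrier k) → LinIndep vs → k ≤ n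
  LinIndep⇒≤n vs indep = Vec-Bool-injection⇒≤ (Inverse.to K↔Vec-Bool ∘ combo vs)
    (LinIndep⇒combo-injective vs indep ∘ Injection.injective (↔⇒↣ K↔Vec-Bool))

  LinIndep-[] : LinIndep []
  LinIndep-[] [] []≢[] _ = []≢[] refl

  LinIndep-++ : ∀ {k l} (us : Vec Carrier k) (vs : Vec Carrier l) → LinIndep us → LinIndep vs →
                (∀ {x} → InSpan us x → InSpan vs x → x ≡ 0#) → LinIndep (us ++ vs)
  LinIndep-++ {k} {l} us vs us-indep vs-indep disjoint S S≢false eq with splitAt k S
  ... | β , α , refl = S≢false (trans (cong₂ _++_ β≡false α≡false) (replicate-++ k l))
    where
    u≡v : combo us β ≡ combo vs α
    u≡v = x+y≡0⇒x≡y (trans (sym (combo-++ us vs β α)) eq)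
    u≡0 = disjoint (β , refl) (α , sym u≡v)
    β≡false = LinIndep⇒≡false us us-indep u≡0
    α≡false = LinIndep⇒≡false vs vs-indep (trans (sym u≡v) u≡0)

  nontrivial-element : ∀ {d} (b : Vec Carrier d) → 2 ≤ d → LinIndep b → ∃ λ x → InSpan b x × x ≢ 0# × x ≢ 1#
  nontrivial-element (_ ∷ [])      (s≤s ()) _
  nontrivial-element (v₀ ∷ v₁ ∷ vs) _        indep with v₀ ≟ 1#
  ... | no  v₀≢1 = v₀ , (true ∷ false ∷ none , in₀) , v₀≢0 , v₀≢1
    where
    none = replicate _ false
    in₀ : v₀ + combo vs none ≡ v₀
    in₀ = trans (cong (v₀ +_) (combo-false vs)) (+-identityʳ v₀)
    v₀≢0 : v₀ ≢ 0#
    v₀≢0 v₀≡0 = indep (true ∷ false ∷ none) (λ ()) (trans in₀ v₀≡0)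
  ... | yes v₀≡1 = v₁ , (false ∷ true ∷ none , in₁) , v₁≢0 , λ v₁≡1 → v₀≢v₁ (trans v₀≡1 (sym v₁≡1))
    where
    none = replicate _ false
    in₁ : v₁ + combo vs none ≡ v₁
    in₁ = trans (cong (v₁ +_) (combo-false vs)) (+-identityʳ v₁)
    v₁≢0 : v₁ ≢ 0#
    v₁≢0 v₁≡0 = indep (false ∷ true ∷ none) (λ ()) (trans in₁ v₁≡0)
    v₀≢v₁ : v₀ ≢ v₁
    v₀≢v₁ v₀≡v₁ = indep (true ∷ true ∷ none) (λ ()) (trans (cong (v₀ +_) in₁) (x≡y⇒x+y≡0 v₀≡v₁))

  spanning⇒n≤ : ∀ {k} (vs : Vec Carrier k) → (∀ x → InSpan vs x) → n ≤ k
  spanning⇒n≤ vs spans = Vec-Bool-injection⇒≤ (proj₁ ∘ spans ∘ Inverse.from K↔Vec-Bool)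
    (Injection.injective (↔⇒↣ (↔-sym K↔Vec-Bool)) ∘ coordinates-agree vs (proj₂ (spans _)) (proj₂ (spans _)))

  rank-nullity : ∀ (g : Carrier → Carrier) → (∀ a b → g (a + b) ≡ g a + g b) →
                 ∀ {k l} (is : Vec Carrier k) (zs : Vec Carrier l) →
                 (∀ x → InSpan is (g x)) → (∀ {x} → g x ≡ 0# → InSpan zs x) → n ≤ k ℕ.+ l
  rank-nullity g g+ is zs image kernel = Vec-Bool-injection⇒≤ (coordinates ∘ Inverse.from K↔Vec-Bool)
    (Injection.injective (↔⇒↣ (↔-sym K↔Vec-Bool)) ∘ coordinates-injective)
    where
    -- x is determined by g x together with x + lift x, which lies in the kernel
    lift : Carrier → Carrier
    lift x = preimage g (g x)
    x+lift∈kernel : ∀ x → g (x + lift x) ≡ 0#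
    x+lift∈kernel x = trans (g+ x (lift x)) (x≡y⇒x+y≡0 (sym (preimage-section g x)))
    coordinates : Carrier → Vec Bool _
    coordinates x = proj₁ (image x) ++ proj₁ (kernel (x+lift∈kernel x))
    coordinates-injective : Injective _≡_ _≡_ coordinates
    coordinates-injective {x} {y} eq = +-cancelʳ (lift y) x y (begin
      x + lift y  ≡⟨ cong (λ z → x + preimage g z) gx≡gy ⟨
      x + lift x  ≡⟨ coordinates-agree zs (proj₂ (kernel _)) (proj₂ (kernel _)) (proj₂ same) ⟩
      y + lift y  ∎)
      where
      open ≡-Reasoning
      same = Vecₚ.++-injective (proj₁ (image x)) (proj₁ (image y)) eq
      gx≡gy = coordinates-agree is (proj₂ (image x)) (proj₂ (image y)) (proj₁ same)

  record Basis (P : Carrier → Set) : Set where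
    field
      dim     : ℕ
      vectors : Vec Carrier dim
      indep   : LinIndep vectors
      inside  : All P vectors
      spans   : ∀ {y} → P y → InSpan vectors y

  basis : ∀ (P : Carrier → Set) → Decidable P → Basis P
  basis P P? = grow n [] [] LinIndep-[] (≤-reflexive (sym (ℕₚ.+-identityʳ n)))
    where
    grow : ∀ fuel {k} (vs : Vec Carrier k) → All P vs → LinIndep vs → n ≤ fuel ℕ.+ k → Basis P
    grow fuel {k} vs inside indep bound with any?K (λ y → P? y ×-dec ¬? (InSpan? vs y)) | fuel
    ... | no ∄y | _ = record
      { vectors = vs ; indep = indep ; inside = inside
      ; spans   = λ {y} p → decidable-stable (InSpan? vs y) (λ y∉ → ∄y (y , p , y∉)) }
    ... | yes (y , p , y∉) | zero       = ⊥-elim (<⇒≱ (LinIndep⇒≤n (y ∷ vs) (LinIndep-∷ indep y∉)) bound)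
    ... | yes (y , p , y∉) | suc fuel′ =
      grow fuel′ (y ∷ vs) (p ∷ inside) (LinIndep-∷ indep y∉) (subst (n ≤_) (sym (+-suc fuel′ k)) bound)

  -- Roots of polynomials

  x+[y+y]≡x : ∀ x y → x + (y + y) ≡ x
  x+[y+y]≡x x y = trans (cong (x +_) (x+x≡0 y)) (+-identityʳ x)

  -- evalMonic (c₀ ∷ … ∷ c_{d-1} ∷ []) x = c₀ + c₁ x + … + c_{d-1} x ^ (d - 1) + x ^ d
  evalMonic : ∀ {d} → Vec Carrier d → Carrier → Carrier
  evalMonic []       x = 1#
  evalMonic (c ∷ cs) x = c + x * evalMonic cs x

  evalMonic-divide : ∀ {d} (cs : Vec Carrier (suc d)) a → ∃ λ (qs : Vec Carrier d) →
                     ∀ x → evalMonic cs x ≡ (x + a) * evalMonic qs x + evalMonic cs a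
  evalMonic-divide (c ∷ []) a = [] , λ x → begin
    c + x * 1#                              ≡⟨ x+[y+y]≡x _ (a * 1#) ⟨
    (c + x * 1#) + (a * 1# + a * 1#)        ≡⟨ solve 3 (λ c x a → (c :+ x :* con 1) :+ (a :* con 1 :+ a :* con 1)
                                                               := (x :+ a) :* con 1 :+ (c :+ a :* con 1)) refl c x a ⟩
    (x + a) * 1# + (c + a * 1#)             ∎
    where open ≡-Reasoning
  evalMonic-divide (c ∷ cs@(_ ∷ _)) a with evalMonic-divide cs a
  ... | qs , divide = p ∷ qs , λ x → begin
    c + x * evalMonic cs x                        ≡⟨ cong (λ y → c + x * y) (divide x) ⟩
    c + x * ((x + a) * q x + p)                   ≡⟨ x+[y+y]≡x _ (a * p) ⟨
    (c + x * ((x + a) * q x + p)) + (a * p + a * p)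
      ≡⟨ solve 5 (λ c x a q p → (c :+ x :* ((x :+ a) :* q :+ p)) :+ (a :* p :+ a :* p)
                               := (x :+ a) :* (p :+ x :* q) :+ (c :+ a :* p)) refl c x a (q x) p ⟩
    (x + a) * (p + x * q x) + (c + a * p)         ∎
    where
    open ≡-Reasoning
    p = evalMonic cs a
    q = evalMonic qs

  evalMonic-roots-≤ : ∀ {d L} (cs : Vec Carrier d) (f : Fin L → Carrier) → Injective _≡_ _≡_ f →
                      (∀ i → evalMonic cs (f i) ≡ 0#) → L ≤ d
  evalMonic-roots-≤ {L = zero}  cs       f _   _     = z≤n
  evalMonic-roots-≤ {L = suc L} []       f _   roots = ⊥-elim (1≢0 (roots zero))
  evalMonic-roots-≤ {L = suc L} (c ∷ cs) f inj roots with evalMonic-divide (c ∷ cs) (f zero)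
  ... | qs , divide = s≤s (evalMonic-roots-≤ qs (f ∘ suc) (Finₚ.suc-injective ∘ inj) roots′)
    where
    roots′ : ∀ i → evalMonic qs (f (suc i)) ≡ 0#
    roots′ i with *-zeroDivisor (begin
        t                                   ≡⟨ +-identityʳ t ⟨
        t + 0#                              ≡⟨ cong (t +_) (roots zero) ⟨
        t + evalMonic (c ∷ cs) (f zero)     ≡⟨ divide (f (suc i)) ⟨
        evalMonic (c ∷ cs) (f (suc i))      ≡⟨ roots (suc i) ⟩
        0#                                  ∎)
      where
      open ≡-Reasoning
      t = (f (suc i) + f zero) * evalMonic qs (f (suc i))
    ... | inj₁ fi≡f0 = ⊥-elim (Finₚ.0≢1+n (sym (inj (x+y≡0⇒x≡y fi≡f0))))
    ... | inj₂ q≡0   = q≡0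

  evalBelow : ∀ {d} → Vec Carrier d → Carrier → Carrier
  evalBelow []       x = 0#
  evalBelow (c ∷ cs) x = c + x * evalBelow cs x

  DegreeBelow : ℕ → (Carrier → Carrier) → Set
  DegreeBelow d p = ∃ λ (cs : Vec Carrier d) → ∀ x → evalBelow cs x ≡ p x

  degreeBelow-0 : ∀ d → DegreeBelow d (λ _ → 0#)
  degreeBelow-0 d = replicate d 0# , eval-0 d
    where
    eval-0 : ∀ d x → evalBelow (replicate d 0#) x ≡ 0#
    eval-0 zero    x = refl
    eval-0 (suc d) x = trans (+-identityˡ _) (trans (cong (x *_) (eval-0 d x)) (zeroʳ x))

  degreeBelow-+ : ∀ {d p q} → DegreeBelow d p → DegreeBelow d q → DegreeBelow d (λ x → p x + q x)
  degreeBelow-+ (cs , eval≡p) (ds , eval≡q) =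
    zipWith _+_ cs ds , λ x → trans (eval-+ cs ds x) (cong₂ _+_ (eval≡p x) (eval≡q x))
    where
    eval-+ : ∀ {d} (cs ds : Vec Carrier d) x → evalBelow (zipWith _+_ cs ds) x ≡ evalBelow cs x + evalBelow ds x
    eval-+ []       []       x = sym (+-identityˡ 0#)
    eval-+ (c ∷ cs) (e ∷ ds) x = trans (cong (λ y → (c + e) + x * y) (eval-+ cs ds x))
      (solve 5 (λ c e x a b → (c :+ e) :+ x :* (a :+ b) := (c :+ x :* a) :+ (e :+ x :* b))
               refl c e x (evalBelow cs x) (evalBelow ds x))

  degreeBelow-pow : ∀ {d k} → k < d → DegreeBelow d (λ x → pow x k)
  degreeBelow-pow {suc d} {zero}  _ = let cs , eval≡0 = degreeBelow-0 d in
    1# ∷ cs , λ x → trans (cong (λ y → 1# + x * y) (eval≡0 x)) (trans (cong (1# +_) (zeroʳ x)) (+-identityʳ 1#))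
  degreeBelow-pow {suc d} {suc k} (s≤s k<d) = let cs , eval≡pow = degreeBelow-pow k<d in
    0# ∷ cs , λ x → trans (+-identityˡ _) (cong (x *_) (eval≡pow x))

  evalMonic≡evalBelow+pow : ∀ {d} (cs : Vec Carrier d) x → evalMonic cs x ≡ evalBelow cs x + pow x d
  evalMonic≡evalBelow+pow []       x = sym (+-identityˡ 1#)
  evalMonic≡evalBelow+pow (c ∷ cs) x = trans (cong (λ y → c + x * y) (evalMonic≡evalBelow+pow cs x))
    (solve 4 (λ c x a b → c :+ x :* (a :+ b) := (c :+ x :* a) :+ x :* b) refl c x (evalBelow cs x) _)

  subspace-of-roots : ∀ {d p} → DegreeBelow d p → ∀ {k} (vs : Vec Carrier k) → LinIndep vs →
                      (∀ S → p (combo vs S) + pow (combo vs S) d ≡ 0#) → 2 ^ k ≤ d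
  subspace-of-roots {d} (cs , eval≡p) {k} vs indep roots = evalMonic-roots-≤ cs (combo vs ∘ subset k)
    (Injection.injective (↔⇒↣ (↔-sym (Vec-Bool↔Fin k))) ∘ LinIndep⇒combo-injective vs indep)
    (λ i → trans (evalMonic≡evalBelow+pow cs _) (trans (cong (_+ _) (eval≡p _)) (roots (subset k i))))

  -- Subspaces over a subfield

  module Subspaces {d} (b : Vec Carrier d) (0<d : 0 < d) (b-indep : LinIndep b)
                   (span-* : ∀ {x y} → InSpan b x → InSpan b y → InSpan b (x * y))
                   (span-inv : ∀ {x} (x≢0 : x ≢ 0#) → InSpan b x → InSpan b (inv x x≢0)) where

    Scalable : ∀ {k} → Vec Carrier k → Set
    Scalable vs = ∀ {f} → InSpan b f → Stable f vs

    scaled : Carrier → Vec Carrier d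
    scaled y = map (_* y) b

    span-scaled : ∀ {f} y → InSpan b f → InSpan (scaled y) (f * y)
    span-scaled y = span-map (_* y) (zeroˡ y) (λ a c → distribʳ y a c) b

    span-scaled⁻ : ∀ {x} y → InSpan (scaled y) x → ∃ λ f → InSpan b f × f * y ≡ x
    span-scaled⁻ y (S , refl) = combo b S , (S , refl) , sym (combo-map (_* y) (zeroˡ y) (λ a c → distribʳ y a c) b S)

    scaled-++-indep : ∀ {k} {vs : Vec Carrier k} {y} → LinIndep vs → Scalable vs → ¬ InSpan vs y →
                      LinIndep (scaled y ++ vs)
    scaled-++-indep {vs = vs} {y} indep scalable y∉ = LinIndep-++ (scaled y) vs scaled-indep indep disjoint
      where
      y≢0 : y ≢ 0#
      y≢0 refl = y∉ (span-0 vs)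
      scaled-indep : LinIndep (scaled y)
      scaled-indep S S≢false eq with *-zeroDivisor (trans (proj₂ (proj₂ (span-scaled⁻ y (S , refl)))) eq)
      ... | inj₁ combo≡0 = b-indep S S≢false combo≡0
      ... | inj₂ y≡0     = y≢0 y≡0
      disjoint : ∀ {x} → InSpan (scaled y) x → InSpan vs x → x ≡ 0#
      disjoint x∈ x∈vs with span-scaled⁻ y x∈
      ... | f , f∈ , refl with f ≟ 0#
      ...   | yes refl = zeroˡ y
      ...   | no  f≢0  = ⊥-elim (y∉ (subst (InSpan vs) (inv-cancelˡ f f≢0 y) (scalable (span-inv f≢0 f∈) x∈vs)))

    scaled-++-scalable : ∀ {k} {vs : Vec Carrier k} {y} → Scalable vs → Scalable (scaled y ++ vs)
    scaled-++-scalable {vs = vs} {y} scalable {f} f∈ x∈ with span-++⁻ (scaled y) vs x∈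
    ... | u , v , u∈ , v∈ , refl with span-scaled⁻ y u∈
    ...   | g , g∈ , refl = subst (InSpan (scaled y ++ vs)) f[gy+v]
      (span-+ (scaled y ++ vs) (span-++ˡ (scaled y) vs (span-scaled y (span-* f∈ g∈)))
                               (span-++ʳ (scaled y) vs (scalable f∈ v∈)))
      where
      f[gy+v] : (f * g) * y + f * v ≡ f * (g * y + v)
      f[gy+v] = trans (cong (_+ f * v) (*-assoc f g y)) (sym (distribˡ f (g * y) v))

    subspace : ∀ j → j ℕ.* d ≤ n → ∃ λ (vs : Vec Carrier (j ℕ.* d)) → LinIndep vs × Scalable vs
    subspace zero    _        = [] , LinIndep-[] , λ { _ ([] , refl) → [] , sym (zeroʳ _) }
    subspace (suc j) [1+j]d≤n with subspace j (≤-trans (ℕₚ.m≤n+m (j ℕ.* d) d) [1+j]d≤n)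
    ... | vs , indep , scalable with any?K (λ y → ¬? (InSpan? vs y))
    ...   | yes (y , y∉) = scaled y ++ vs , scaled-++-indep indep scalable y∉ , scaled-++-scalable scalable
    ...   | no  ∄y       = ⊥-elim (<⇒≱ (ℕₚ.<-≤-trans (ℕₚ.m<n+m (j ℕ.* d) 0<d) [1+j]d≤n)
                                      (spanning⇒n≤ vs λ x → decidable-stable (InSpan? vs x) (λ x∉ → ∄y (x , x∉))))

  spanSum : ∀ {k} → (Carrier → Carrier) → Vec Carrier k → Carrier
  spanSum {k} g vs = Σ.sum (λ i → g (combo vs (subset k i)))

  affSum≡sum : ∀ (g : Carrier → Carrier) a {k} (vs : Vec Carrier k) →
               affSum g a vs ≡ Σ.sum (λ i → g (a + combo vs (subset k i)))
  affSum≡sum g a []                = sym (trans (+-identityʳ _) (cong g (+-identityʳ a)))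
  affSum≡sum g a {suc k} (v ∷ vs) = sym (begin
    Σ.sum G
      ≡⟨ sum-combine +-commutativeMonoid (2 ^ k) G ⟩
    Σ.sum (G ∘ combine {2} {2 ^ k} zero) + Σ.sum (G ∘ combine {2} {2 ^ k} (suc zero))
      ≡⟨ cong₂ _+_ (Σ.sum-cong-≗ G-false) (Σ.sum-cong-≗ G-true) ⟩
    Σ.sum (λ i → g (a + combo vs (subset k i))) + Σ.sum (λ i → g ((a + v) + combo vs (subset k i)))
      ≡⟨ cong₂ _+_ (affSum≡sum g a vs) (affSum≡sum g (a + v) vs) ⟨
    affSum g a (v ∷ vs) ∎)
    where
    open ≡-Reasoning
    G : Fin (2 ^ suc k) → Carrier
    G i = g (a + combo (v ∷ vs) (subset (suc k) i))
    G-false : ∀ i → G (combine {2} {2 ^ k} zero i) ≡ g (a + combo vs (subset k i))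
    G-false i = cong (λ S → g (a + combo (v ∷ vs) S)) (subset-combine zero i)
    G-true : ∀ i → G (combine {2} {2 ^ k} (suc zero) i) ≡ g ((a + v) + combo vs (subset k i))
    G-true i = trans (cong (λ S → g (a + combo (v ∷ vs) S)) (subset-combine (suc zero) i))
                     (cong g (sym (+-assoc a v _)))

  affSum-0≡spanSum : ∀ (g : Carrier → Carrier) {k} (vs : Vec Carrier k) → affSum g 0# vs ≡ spanSum g vs
  affSum-0≡spanSum g {k} vs =
    trans (affSum≡sum g 0# vs) (Σ.sum-cong-≗ λ i → cong g (+-identityˡ (combo vs (subset k i))))

  spanSum-scale : ∀ {k} (vs : Vec Carrier k) → LinIndep vs → ∀ {x} (x≢0 : x ≢ 0#) →
                  Stable x vs → Stable (inv x x≢0) vs →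
                  ∀ g → spanSum g vs ≡ spanSum (g ∘ (x *_)) vs
  spanSum-scale {k} vs indep {x} x≢0 scale scale⁻¹ g =
    trans (sum-invariant +-commutativeMonoid (Vec-Bool↔Fin k) σ (g ∘ combo vs))
          (Σ.sum-cong-≗ λ i → cong g (proj₂ (scale (subset k i , refl))))
    where
    σ : Vec Bool k ↔ Vec Bool k
    σ = mk↔ₛ′ (λ S → proj₁ (scale (S , refl))) (λ S → proj₁ (scale⁻¹ (S , refl)))
      (λ S → LinIndep⇒combo-injective vs indep
               (trans (proj₂ (scale _)) (trans (cong (x *_) (proj₂ (scale⁻¹ _))) (inv-cancelʳ x x≢0 _))))
      (λ S → LinIndep⇒combo-injective vs indep
               (trans (proj₂ (scale⁻¹ _)) (trans (cong (_ *_) (proj₂ (scale _))) (inv-cancelˡ x x≢0 _))))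

  Finv≢1 : ∀ {x} → x ≢ 0# → x ≢ 1# → Finv x ≢ 1#
  Finv≢1 {x} x≢0 x≢1 Finv≡1 = x≢1 (*-cancelˡ-nonZero x x 1# x≢0 (begin
    x * x                           ≡⟨ pow-2 x ⟨
    pow x 2                         ≡⟨ *-identityˡ _ ⟨
    1# * pow x 2                    ≡⟨ cong (_* pow x 2) Finv≡1 ⟨
    Finv x * pow x 2                ≡⟨ pow-+ x (2 ^ n ∸ 2) 2 ⟨
    pow x (2 ^ n ∸ 2 ℕ.+ 2)         ≡⟨ cong (pow x) (ℕₚ.m∸n+n≡m 2≤2^n) ⟩
    pow x (2 ^ n)                   ≡⟨ fermat x ⟩
    x                               ≡⟨ *-identityʳ x ⟨
    x * 1#                          ∎))
    where open ≡-Reasoning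

  affSum-Finv≡0 : ∀ {k} (vs : Vec Carrier k) → LinIndep vs → ∀ {x} (x≢0 : x ≢ 0#) → x ≢ 1# →
                  Stable x vs → Stable (inv x x≢0) vs →
                  affSum Finv 0# vs ≡ 0#
  affSum-Finv≡0 {k} vs indep {x} x≢0 x≢1 scale scale⁻¹ with *-zeroDivisor [Finv[x]+1]Σ≡0
    where
    Σ′ = spanSum Finv vs
    Σ′≡Finv[x]Σ′ : Σ′ ≡ Finv x * Σ′
    Σ′≡Finv[x]Σ′ = trans (spanSum-scale vs indep x≢0 scale scale⁻¹ Finv)
      (trans (Σ.sum-cong-≗ λ i → pow-distrib-* x (combo vs (subset k i)) (2 ^ n ∸ 2))
             (sym (Σ.*-distribˡ-sum (Finv x) (λ i → Finv (combo vs (subset k i))))))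
    [Finv[x]+1]Σ≡0 : (Finv x + 1#) * Σ′ ≡ 0#
    [Finv[x]+1]Σ≡0 =
      trans (distribʳ Σ′ (Finv x) 1#) (x≡y⇒x+y≡0 (trans (sym Σ′≡Finv[x]Σ′) (sym (*-identityˡ Σ′))))
  ... | inj₁ Finv[x]+1≡0 = ⊥-elim (Finv≢1 x≢0 x≢1 (x+y≡0⇒x≡y Finv[x]+1≡0))
  ... | inj₂ Σ≡0         = trans (affSum-0≡spanSum Finv vs) Σ≡0

  -- The fixed field of x ↦ x ^ (2 ^ s)

  module FixedField (s m : ℕ) (0<s : 0 < s) (n≡[1+m]s : n ≡ suc m ℕ.* s) where

    Q : ℕ
    Q = 2 ^ s

    1<Q : 1 < Q
    1<Q = ^-monoʳ-< 2 (s≤s (s≤s z≤n)) 0<s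

    Fixed : Carrier → Set
    Fixed x = pow x Q ≡ x

    Fixed-0 : Fixed 0#
    Fixed-0 = pow-0# Q (m^n>0 2 s)

    Fixed-+ : ∀ {a b} → Fixed a → Fixed b → Fixed (a + b)
    Fixed-+ {a} {b} a-fixed b-fixed = trans (frobenius-+ s a b) (cong₂ _+_ a-fixed b-fixed)

    Fixed-* : ∀ {a b} → Fixed a → Fixed b → Fixed (a * b)
    Fixed-* {a} {b} a-fixed b-fixed = trans (pow-distrib-* a b Q) (cong₂ _*_ a-fixed b-fixed)

    Fixed-inv : ∀ {a} (a≢0 : a ≢ 0#) → Fixed a → Fixed (inv a a≢0)
    Fixed-inv {a} a≢0 a-fixed = *-cancelˡ-nonZero a _ _ a≢0 (begin
      a * pow a⁻¹ Q          ≡⟨ cong (_* pow a⁻¹ Q) a-fixed ⟨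
      pow a Q * pow a⁻¹ Q    ≡⟨ pow-distrib-* a a⁻¹ Q ⟨
      pow (a * a⁻¹) Q        ≡⟨ cong (λ y → pow y Q) (inv-inverseʳ a a≢0) ⟩
      pow 1# Q               ≡⟨ pow-1# Q ⟩
      1#                     ≡⟨ inv-inverseʳ a a≢0 ⟨
      a * a⁻¹                ∎)
      where
      open ≡-Reasoning
      a⁻¹ = inv a a≢0

    pow-Q^-+ : ∀ i a b → pow (a + b) (Q ^ i) ≡ pow a (Q ^ i) + pow b (Q ^ i)
    pow-Q^-+ i a b rewrite ^-*-assoc 2 s i = frobenius-+ (s ℕ.* i) a b

    partialTrace : ℕ → Carrier → Carrier
    partialTrace zero    x = 0#
    partialTrace (suc j) x = partialTrace j x + pow x (Q ^ j)

    partialTrace-+ : ∀ j a b → partialTrace j (a + b) ≡ partialTrace j a + partialTrace j b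
    partialTrace-+ zero    a b = sym (+-identityˡ 0#)
    partialTrace-+ (suc j) a b = trans (cong₂ _+_ (partialTrace-+ j a b) (pow-Q^-+ j a b))
      (solve 4 (λ a b c d → (a :+ b) :+ (c :+ d) := (a :+ c) :+ (b :+ d)) refl (partialTrace j a) (partialTrace j b) _ _)

    -- x ↦ x ^ Q shifts the terms of the partial trace by one
    pow-partialTrace : ∀ j x → pow (partialTrace j x) Q + x ≡ partialTrace j x + pow x (Q ^ j)
    pow-partialTrace zero    x = trans (cong (_+ x) Fixed-0) (cong (0# +_) (sym (*-identityʳ x)))
    pow-partialTrace (suc j) x = begin
      pow (partialTrace j x + y) Q + x             ≡⟨ cong (_+ x) (frobenius-+ s (partialTrace j x) y) ⟩
      (pow (partialTrace j x) Q + pow y Q) + x     ≡⟨ solve 3 (λ a b c → (a :+ b) :+ c := (a :+ c) :+ b) refl _ (pow y Q) x ⟩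
      (pow (partialTrace j x) Q + x) + pow y Q     ≡⟨ cong₂ _+_ (pow-partialTrace j x) (sym (pow-* x (Q ^ j) Q)) ⟩
      (partialTrace j x + y) + pow x (Q ^ j ℕ.* Q) ≡⟨ cong (λ e → partialTrace j x + y + pow x e) (ℕₚ.*-comm (Q ^ j) Q) ⟩
      (partialTrace j x + y) + pow x (Q ^ suc j)   ∎
      where
      open ≡-Reasoning
      y = pow x (Q ^ j)

    trace : Carrier → Carrier
    trace = partialTrace (suc m)

    trace-Fixed : ∀ x → Fixed (trace x)
    trace-Fixed x = +-cancelʳ x _ _ (begin
      pow (trace x) Q + x            ≡⟨ pow-partialTrace (suc m) x ⟩
      trace x + pow x (Q ^ suc m)    ≡⟨ cong (λ e → trace x + pow x e) Q^[1+m]≡2^n ⟩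
      trace x + pow x (2 ^ n)        ≡⟨ cong (trace x +_) (fermat x) ⟩
      trace x + x                    ∎)
      where
      open ≡-Reasoning
      Q^[1+m]≡2^n : Q ^ suc m ≡ 2 ^ n
      Q^[1+m]≡2^n = trans (^-*-assoc 2 s (suc m)) (cong (2 ^_) (trans (ℕₚ.*-comm s (suc m)) (sym n≡[1+m]s)))

    Fixed-dim : ∀ {k} (vs : Vec Carrier k) → LinIndep vs → All Fixed vs → k ≤ s
    Fixed-dim vs indep fixed = 2^-cancel-≤ (subspace-of-roots (degreeBelow-pow 1<Q) vs indep root)
      where
      root : ∀ S → pow (combo vs S) 1 + pow (combo vs S) Q ≡ 0#
      root S = x≡y⇒x+y≡0 (trans (*-identityʳ _) (sym (span-least Fixed Fixed-0 Fixed-+ fixed (S , refl))))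

    Kernel : Carrier → Set
    Kernel x = trace x ≡ 0#

    Kernel-0 : Kernel 0#
    Kernel-0 = x+x≈x⇒x≈0 _ (trans (sym (partialTrace-+ (suc m) 0# 0#)) (cong trace (+-identityʳ 0#)))

    Kernel-+ : ∀ {a b} → Kernel a → Kernel b → Kernel (a + b)
    Kernel-+ {a} {b} a∈ b∈ = trans (partialTrace-+ (suc m) a b) (trans (cong₂ _+_ a∈ b∈) (+-identityˡ 0#))

    Kernel-dim : ∀ {k} (vs : Vec Carrier k) → LinIndep vs → All Kernel vs → k ≤ s ℕ.* m
    Kernel-dim vs indep kernel =
      2^-cancel-≤ (subst (_ ≤_) (^-*-assoc 2 s m) (subspace-of-roots (below m ≤-refl) vs indep root))
      where
      below : ∀ j → j ≤ m → DegreeBelow (Q ^ m) (partialTrace j)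
      below zero    _   = degreeBelow-0 (Q ^ m)
      below (suc j) j<m = degreeBelow-+ (below j (≤-trans (n≤1+n j) j<m)) (degreeBelow-pow (^-monoʳ-< Q 1<Q j<m))
      root : ∀ S → partialTrace m (combo vs S) + pow (combo vs S) (Q ^ m) ≡ 0#
      root S = span-least Kernel Kernel-0 Kernel-+ kernel (S , refl)

    fixedBasis : Basis Fixed
    fixedBasis = basis Fixed (λ x → pow x Q ≟ x)

    open Basis fixedBasis

    dim≡s : dim ≡ s
    dim≡s = ℕₚ.≤-antisym (Fixed-dim vectors indep inside) (ℕₚ.+-cancelʳ-≤ (s ℕ.* m) s dim (begin
      s ℕ.+ s ℕ.* m                    ≡⟨ cong (s ℕ.+_) (ℕₚ.*-comm s m) ⟩
      suc m ℕ.* s                      ≡⟨ n≡[1+m]s ⟨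
      n                                ≤⟨ rank-nullity trace (partialTrace-+ (suc m)) vectors Z.vectors (spans ∘ trace-Fixed) Z.spans ⟩
      dim ℕ.+ Z.dim                    ≤⟨ ℕₚ.+-monoʳ-≤ dim (Kernel-dim Z.vectors Z.indep Z.inside) ⟩
      dim ℕ.+ s ℕ.* m                  ∎))
      where
      open ℕₚ.≤-Reasoning
      module Z = Basis (basis Kernel (λ x → trace x ≟ 0#))

    span-Fixed : ∀ {x} → InSpan vectors x → Fixed x
    span-Fixed = span-least Fixed Fixed-0 Fixed-+ inside

    span-* : ∀ {x y} → InSpan vectors x → InSpan vectors y → InSpan vectors (x * y)
    span-* x∈ y∈ = spans (Fixed-* (span-Fixed x∈) (span-Fixed y∈))

    span-inv : ∀ {x} (x≢0 : x ≢ 0#) → InSpan vectors x → InSpan vectors (inv x x≢0)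
    span-inv x≢0 x∈ = spans (Fixed-inv x≢0 (span-Fixed x∈))

  Finv-not-sumFree : ∀ s m r → 2 ≤ s → n ≡ suc m ℕ.* s → r ≤ suc m → ¬ SumFree (s ℕ.* r) Finv
  Finv-not-sumFree s m r 2≤s n≡[1+m]s r≤1+m =
    subst (λ k → ¬ SumFree k Finv) (trans (cong (r ℕ.*_) dim≡s) (ℕₚ.*-comm r s)) not-sumFree
    where
    0<s = ≤-trans (s≤s z≤n) 2≤s
    open FixedField s m 0<s n≡[1+m]s
    open Basis fixedBasis
    open Subspaces vectors (subst (0 <_) (sym dim≡s) 0<s) indep span-* span-inv
    r*dim≤n : r ℕ.* dim ≤ n
    r*dim≤n = subst₂ _≤_ (cong (r ℕ.*_) (sym dim≡s)) (sym n≡[1+m]s) (ℕₚ.*-monoˡ-≤ s r≤1+m)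
    not-sumFree : ¬ SumFree (r ℕ.* dim) Finv
    not-sumFree sumFree =
      let vs , vs-indep , scalable = subspace r r*dim≤n
          x , x∈ , x≢0 , x≢1       = nontrivial-element vectors (subst (2 ≤_) (sym dim≡s) 2≤s) indep
      in sumFree 0# vs vs-indep (affSum-Finv≡0 vs vs-indep x≢0 x≢1 (scalable x∈) (scalable (span-inv x≢0 x∈)))

-- opened only here: inside the development above it would clash with the field's _*_
open import Data.Nat using (_*_)

corollary2p3 : (n s r : ℕ) → .{{_ : NonZero n}} → .{{_ : NonZero s}} → 2 ≤ s → s ∣ n → r ≤ n / s
    → (∃ λ (d : Poly₂) → HasDegree d r × DividesX^+1 d (n / s))
    → (K : FiniteField2^ n) → ¬ FiniteField2^.SumFree K (s * r) (FiniteField2^.Finv K)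
corollary2p3 n s r 2≤s (divides zero    n≡0) _      _ K = ⊥-elim (ℕ.≢-nonZero⁻¹ n n≡0)
corollary2p3 n s r 2≤s (divides (suc m) n≡[1+m]s) r≤n/s _ K =
  Finv-not-sumFree K s m r 2≤s n≡[1+m]s (subst (r ≤_) n/s≡1+m r≤n/s)
  where
  n/s≡1+m : n / s ≡ suc m
  n/s≡1+m = trans (cong (_/ s) n≡[1+m]s) (m*n/n≡m (suc m) s)
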